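{- Let $G$ be a graph on $n\ge 3$ vertices. Then $G\notin\mathrm{BP2}$ if and only if $\bar G$ is connected, $\bar G$ has no cut vertex, and every vertex cut $X$ of $\bar G$ (if any exists) induces a connected subgraph $\bar G[X]$.
   Context: All graphs are finite, simple and undirected. A biclique of a graph $G$ is a subgraph of $G$ isomorphic to $K_1$ or to $K_{m,n}$ for some $m,n\ge1$. BP2 is the set of graphs whose vertex set can be covered by at most two bicliques. $\bar G$ is the complement of $G$. A cut vertex of a connected graph $H$ is a vertex $v$ with $H-v$ disconnected; a vertex cut of a connected graph $H$ is a set $X\subseteq V(H)$ with $H-X$ disconnected. -}

module Defs where

open import Data.Nat using (ℕ; _≤_)
open import Data.Bool using (Bool; true; false; not; if_then_else_)
open import Data.Fin using (Fin; _≟_)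
open import Data.Fin.Subset using (Subset; _∈_; _∩_; Nonempty; Empty; ⊤; ∁; _-_)
open import Data.List using (List; length)
open import Data.List.Relation.Unary.Any using (Any)
open import Data.Product using (Σ; _×_)
open import Data.Sum using (_⊎_)
open import Relation.Nullary using (¬_; yes; no)
open import Relation.Binary.PropositionalEquality using (_≡_; refl; sym; cong)
open import Data.Empty using (⊥-elim)

record Graph (n : ℕ) : Set where
  field
    adj    : Fin n → Fin n → Bool
    adj-sym    : ∀ u v → adj u v ≡ adj v u
    adj-irrefl : ∀ v → adj v v ≡ false
open Graph public

cadj : ∀ {n} → Graph n → Fin n → Fin n → Bool
cadj G u v with u ≟ v
... | yes _ = false
... | no _  = not (adj G u v)

cadj-sym : ∀ {n} (G : Graph n) u v → cadj G u v ≡ cadj G v u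
cadj-sym G u v with u ≟ v | v ≟ u
... | yes _ | yes _ = refl
... | yes p | no q = ⊥-elim (q (sym p))
... | no p | yes q = ⊥-elim (p (sym q))
... | no _ | no _ = cong not (adj-sym G u v)

cadj-irrefl : ∀ {n} (G : Graph n) v → cadj G v v ≡ false
cadj-irrefl G v with v ≟ v
... | yes _ = refl
... | no p = ⊥-elim (p refl)

co : ∀ {n} → Graph n → Graph n
co G = record { adj = cadj G ; adj-sym = cadj-sym G ; adj-irrefl = cadj-irrefl G }

-- A biclique of G: either a single vertex (K₁), or a (not necessarily induced)
-- complete bipartite subgraph K_{|A|,|B|} with disjoint nonempty sides A, B.
data Biclique {n : ℕ} (G : Graph n) : Set where
  single : Fin n → Biclique G
  bip    : (A B : Subset n) → Nonempty A → Nonempty B → Empty (A ∩ B)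
         → (∀ a b → a ∈ A → b ∈ B → adj G a b ≡ true) → Biclique G

_∈B_ : ∀ {n} {G : Graph n} → Fin n → Biclique G → Set
v ∈B single w = v ≡ w
v ∈B bip A B _ _ _ _ = v ∈ A ⊎ v ∈ B

BP2 : ∀ {n} → Graph n → Set
BP2 {n} G = Σ (List (Biclique G)) λ bs → length bs ≤ 2 × (∀ (v : Fin n) → Any (v ∈B_) bs)

data Reach {n : ℕ} (H : Graph n) (S : Subset n) : Fin n → Fin n → Set where
  here : ∀ {u} → u ∈ S → Reach H S u u
  step : ∀ {u w v} → u ∈ S → adj H u w ≡ true → Reach H S w v → Reach H S u v

ConnectedOn : ∀ {n} → Graph n → Subset n → Set
ConnectedOn H S = Nonempty S × (∀ u v → u ∈ S → v ∈ S → Reach H S u v)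

DisconnectedOn : ∀ {n} → Graph n → Subset n → Set
DisconnectedOn H S = Σ _ λ u → Σ _ λ v → u ∈ S × v ∈ S × ¬ Reach H S u v

Connected : ∀ {n} → Graph n → Set
Connected H = ConnectedOn H ⊤

IsCutVertex : ∀ {n} → Graph n → Fin n → Set
IsCutVertex H v = DisconnectedOn H (⊤ - v)

IsVertexCut : ∀ {n} → Graph n → Subset n → Set
IsVertexCut H X = DisconnectedOn H (∁ X)

module Submission where

-- Two elementary facts link the bicliques of G
-- with the connectivity of Ḡ:
--   * separation: if a set S is covered by two sides P, Q that are completely joined
--     in G, then no path of Ḡ[S] leads from P to Q, since no Ḡ-edge crosses the sides;
--   * component split: conversely, if Ḡ[S] is disconnected, the component of a vertex a
--     and the rest of S are completely joined in G, so S lies in one biclique of G.  For n ≥ 1, G ∈ BP2 iff V is covered by two bicliques ("TwoCover").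
-- (⇒) Each failure of the condition (Ḡ disconnected; a cut vertex v; a vertex cut X
--     with Ḡ[X] empty or disconnected) cuts V into at most two parts, each inside a
--     biclique ({v} counts as K₁), giving a two-cover.
-- (⇐) Under the condition, Ḡ[∁ S] is connected whenever Ḡ[S] is disconnected; hence
--     every biclique misses some vertex.  This excludes covers by two vertices (n ≥ 3),
--     by a vertex and a biclique (the vertex would cut Ḡ) and by two bicliques (their
--     sides would be forced to coincide, which disconnects Ḡ).

open import Defs
open import Data.Nat using (ℕ; zero; suc; _≤_; s≤s; z≤n)
open import Data.Nat.Properties using (≤-refl; ≤-trans; ≤-pred; <-≤-trans; n≮0)
open import Data.Bool using (true; false)
open import Data.Bool.Properties using (not-involutive) renaming (_≟_ to _≟ᵇ_)
open import Data.Fin using (Fin; _≟_; fromℕ<) renaming (zero to fz; suc to fs)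
open import Data.Fin.Properties using (any?)
open import Data.Fin.Subset
  using (Subset; _∈_; _∉_; _⊆_; ⊤; ∁; _∪_; _∩_; _-_; ⁅_⁆; ∣_∣; Nonempty; Empty)
open import Data.Fin.Subset.Properties
  using (_∈?_; ∈⊤; nonempty?; p─q⊆p; x∈p∧x≢y⇒x∈p-y; x∈p⇒∣p-x∣<∣p∣;
         x∈∁p⇒x∉p; x∉p⇒x∈∁p; x∈p∪q⁺; x∈p∪q⁻; x∈p∩q⁻)
open import Data.Vec using (_∷_; []; tabulate; here; there)
open import Data.Vec.Properties using (lookup∘tabulate; lookup⇒[]=; []=⇒lookup)
open import Data.List using ([]; _∷_)
open import Data.List.Relation.Unary.Any as Any using (Any)
open import Data.List.Relation.Unary.Any.Properties using (singleton⁻)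
open import Data.Product using (Σ; ∃-syntax; _×_; _,_; proj₁; proj₂)
open import Data.Sum using (_⊎_; inj₁; inj₂; [_,_]′) renaming (swap to ⊎-swap; map to ⊎-map)
open import Data.Empty using (⊥; ⊥-elim)
open import Function using (_∘_; id)
open import Function.Bundles using (_⇔_; mk⇔; Equivalence)
open import Relation.Nullary using (¬_; Dec; yes; no; does)
open import Relation.Nullary.Decidable
  using (map′; dec-true; dec-false; decidable-stable; ¬?; _×-dec_; _⊎-dec_)
open import Level using (0ℓ)
open import Relation.Unary using (Pred; Decidable)
open import Relation.Binary.PropositionalEquality
  using (_≡_; _≢_; refl; sym; trans; cong₂; subst)

x∈p-y⇒x≢y : ∀ {n} {p : Subset n} {x y : Fin n} → x ∈ p - y → x ≢ y
x∈p-y⇒x≢y {p = _ ∷ _} {fz}   () refl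
x∈p-y⇒x≢y {p = _ ∷ _} {fs x} (there x∈p-x) refl = x∈p-y⇒x≢y x∈p-x refl

∁-involutive : ∀ {n} (p : Subset n) → ∁ (∁ p) ≡ p
∁-involutive []      = refl
∁-involutive (s ∷ p) = cong₂ _∷_ (not-involutive s) (∁-involutive p)

third : ∀ {n} → 3 ≤ n → (v w : Fin n) → ∃[ x ] (x ≢ v × x ≢ w)
third (s≤s (s≤s (s≤s _))) fz      fz           = fs fz , (λ ()) , (λ ())
third (s≤s (s≤s (s≤s _))) fz      (fs fz)      = fs (fs fz) , (λ ()) , (λ ())
third (s≤s (s≤s (s≤s _))) fz      (fs (fs _))  = fs fz , (λ ()) , (λ ())
third (s≤s (s≤s (s≤s _))) (fs fz) fz           = fs (fs fz) , (λ ()) , (λ ())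
third (s≤s (s≤s (s≤s _))) (fs fz) (fs _)       = fz , (λ ()) , (λ ())
third (s≤s (s≤s (s≤s _))) (fs (fs _)) fz       = fs fz , (λ ()) , (λ ())
third (s≤s (s≤s (s≤s _))) (fs (fs _)) (fs _)   = fz , (λ ()) , (λ ())

⟦_⟧ : ∀ {n} {P : Pred (Fin n) 0ℓ} → Decidable P → Subset n
⟦ P? ⟧ = tabulate (λ x → does (P? x))

∈⟦⟧⁺ : ∀ {n} {P : Pred (Fin n) 0ℓ} (P? : Decidable P) {x} → P x → x ∈ ⟦ P? ⟧
∈⟦⟧⁺ P? {x} px = lookup⇒[]= x _ (trans (lookup∘tabulate _ x) (dec-true (P? x) px))

∈⟦⟧⁻ : ∀ {n} {P : Pred (Fin n) 0ℓ} (P? : Decidable P) {x} → x ∈ ⟦ P? ⟧ → P x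
∈⟦⟧⁻ P? {x} x∈ = decidable-stable (P? x) λ ¬px →
  false≢true (trans (sym (dec-false (P? x) ¬px))
                    (trans (sym (lookup∘tabulate _ x)) ([]=⇒lookup x∈)))
  where
  false≢true : false ≢ true
  false≢true ()

module Reachability {n : ℕ} (H : Graph n) where

  Reach-head : ∀ {S u v} → Reach H S u v → u ∈ S
  Reach-head (here u∈S)     = u∈S
  Reach-head (step u∈S _ _) = u∈S

  Reach-snoc : ∀ {S u v w} → Reach H S u v → adj H v w ≡ true → w ∈ S → Reach H S u w
  Reach-snoc (here u∈S)       vw w∈S = step u∈S vw (here w∈S)
  Reach-snoc (step u∈S uu′ r) vw w∈S = step u∈S uu′ (Reach-snoc r vw w∈S)

  Reach-mono : ∀ {S T u v} → S ⊆ T → Reach H S u v → Reach H T u v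
  Reach-mono S⊆T (here u∈S)      = here (S⊆T u∈S)
  Reach-mono S⊆T (step u∈S uw r) = step (S⊆T u∈S) uw (Reach-mono S⊆T r)

  -- How a path x ⇝ v in H[S] relates to a vertex u: it avoids u, or it ends at u, or it
  -- leaves u for the last time along an edge uw and then stays inside S - u.
  data LastVisit (S : Subset n) (u x v : Fin n) : Set where
    avoids : Reach H (S - u) x v → LastVisit S u x v
    ends   : u ≡ v → LastVisit S u x v
    leaves : ∀ {w} → adj H u w ≡ true → Reach H (S - u) w v → LastVisit S u x v

  lastVisit : ∀ {S x v} u → Reach H S x v → LastVisit S u x v
  lastVisit u (here {x} x∈S) with x ≟ u
  ... | yes refl = ends refl
  ... | no x≢u   = avoids (here (x∈p∧x≢y⇒x∈p-y x∈S x≢u))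
  lastVisit u (step {x} x∈S xw r) with lastVisit u r
  ... | ends u≡v     = ends u≡v
  ... | leaves uw r′ = leaves uw r′
  ... | avoids r′ with x ≟ u
  ...   | yes refl = leaves xw r′
  ...   | no x≢u   = avoids (step (x∈p∧x≢y⇒x∈p-y x∈S x≢u) xw r′)

  Reach-unfold : ∀ {S u v} → u ∈ S → u ≢ v →
                 Reach H S u v ⇔ (∃[ w ] (adj H u w ≡ true × Reach H (S - u) w v))
  Reach-unfold {S} {u} {v} u∈S u≢v =
    mk⇔ first-step (λ (_ , uw , r) → step u∈S uw (Reach-mono (p─q⊆p S ⁅ u ⁆) r))
    where
    first-step : Reach H S u v → ∃[ w ] (adj H u w ≡ true × Reach H (S - u) w v)
    first-step r with lastVisit u r
    ... | avoids r′    = ⊥-elim (x∈p-y⇒x≢y (Reach-head r′) refl)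
    ... | ends u≡v     = ⊥-elim (u≢v u≡v)
    ... | leaves uw r′ = _ , uw , r′

  -- Reachability in H[S] is decidable, by induction on an upper bound for |S|.
  reach?-bounded : ∀ k S → ∣ S ∣ ≤ k → ∀ u v → Dec (Reach H S u v)
  reach?-bounded zero S |S|≤0 u v =
    no λ r → n≮0 (<-≤-trans (x∈p⇒∣p-x∣<∣p∣ (Reach-head r)) |S|≤0)
  reach?-bounded (suc k) S |S|≤k+1 u v with u ∈? S
  ... | no u∉S = no (u∉S ∘ Reach-head)
  ... | yes u∈S with u ≟ v
  ...   | yes refl = yes (here u∈S)
  ...   | no u≢v   =
          map′ (Equivalence.from unfold) (Equivalence.to unfold)
               (any? λ w → (adj H u w ≟ᵇ true) ×-dec reach?-bounded k (S - u) |S-u|≤k w v)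
    where
    unfold : Reach H S u v ⇔ (∃[ w ] (adj H u w ≡ true × Reach H (S - u) w v))
    unfold = Reach-unfold u∈S u≢v
    |S-u|≤k : ∣ S - u ∣ ≤ k
    |S-u|≤k = ≤-pred (≤-trans (x∈p⇒∣p-x∣<∣p∣ u∈S) |S|≤k+1)

  reach? : ∀ S u v → Dec (Reach H S u v)
  reach? S = reach?-bounded ∣ S ∣ S ≤-refl

module _ {n : ℕ} (G : Graph n) where

  open Reachability (co G)

  Condition : Set
  Condition = Connected (co G)
            × (∀ (v : Fin n) → ¬ IsCutVertex (co G) v)
            × (∀ (X : Subset n) → IsVertexCut (co G) X → ConnectedOn (co G) X)

  Complete : (P Q : Fin n → Set) → Set
  Complete P Q = ∀ {p q} → P p → Q q → adj G p q ≡ true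

  adj⇒¬co-adj : ∀ {x y} → adj G x y ≡ true → adj (co G) x y ≡ false
  adj⇒¬co-adj {x} {y} xy with x ≟ y
  ... | yes _ = refl
  ... | no _ rewrite xy = refl

  ¬co-adj⇒adj : ∀ {x y} → x ≢ y → adj (co G) x y ≡ false → adj G x y ≡ true
  ¬co-adj⇒adj {x} {y} x≢y ¬xy with x ≟ y
  ... | yes x≡y = ⊥-elim (x≢y x≡y)
  ... | no _ with adj G x y
  ...   | true  = refl
  ...   | false = sym ¬xy

  -- Separation: inside a set covered by completely joined sides P and Q, no path of Ḡ
  -- goes from P to Q, as every Ḡ-edge stays within one side.
  no-crossing : ∀ {S P Q} → (∀ {z} → z ∈ S → P z ⊎ Q z) → Complete P Q →
                ∀ {u v} → P u → Q v → ¬ Reach (co G) S u v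
  no-crossing cover PQ pu qu (here _) with trans (sym (PQ pu qu)) (adj-irrefl G _)
  ... | ()
  no-crossing cover PQ pu qv (step _ uw r) with cover (Reach-head r)
  ... | inj₁ pw = no-crossing cover PQ pw qv r
  ... | inj₂ qw with trans (sym uw) (adj⇒¬co-adj (PQ pu qw))
  ...   | ()

  separated : ∀ {S P Q a b} → (∀ {z} → z ∈ S → P z ⊎ Q z) → Complete P Q →
              a ∈ S → P a → b ∈ S → Q b → DisconnectedOn (co G) S
  separated cover PQ a∈S pa b∈S qb = _ , _ , a∈S , b∈S , no-crossing cover PQ pa qb

  -- Component split: if Ḡ[S] is disconnected, the vertices of S reachable from a and the
  -- remaining ones form a biclique of G containing S.
  component-split : ∀ {S} → DisconnectedOn (co G) S → Σ (Biclique G) λ β → ∀ {x} → x ∈ S → x ∈B β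
  component-split {S} (a , b , a∈S , b∈S , a↛b) =
    bip A B (a , ∈⟦⟧⁺ InA? (here a∈S)) (b , ∈⟦⟧⁺ InB? (b∈S , a↛b)) disjoint complete , cover
    where
    InA? : Decidable (Reach (co G) S a)
    InA? = reach? S a
    InB? : Decidable (λ x → x ∈ S × ¬ Reach (co G) S a x)
    InB? x = (x ∈? S) ×-dec ¬? (reach? S a x)
    A B : Subset n
    A = ⟦ InA? ⟧
    B = ⟦ InB? ⟧

    disjoint : Empty (A ∩ B)
    disjoint (x , x∈A∩B) with x∈p∩q⁻ A B x∈A∩B
    ... | x∈A , x∈B = proj₂ (∈⟦⟧⁻ InB? x∈B) (∈⟦⟧⁻ InA? x∈A)

    -- A Ḡ-edge from a reachable x to y ∈ S would make y reachable.
    across : ∀ {x y} → Reach (co G) S a x → y ∈ S → ¬ Reach (co G) S a y → adj G x y ≡ true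
    across {x} {y} a⇝x y∈S a↛y with x ≟ y
    ... | yes refl = ⊥-elim (a↛y a⇝x)
    ... | no x≢y with adj (co G) x y in xy
    ...   | true  = ⊥-elim (a↛y (Reach-snoc a⇝x xy y∈S))
    ...   | false = ¬co-adj⇒adj x≢y xy

    complete : ∀ x y → x ∈ A → y ∈ B → adj G x y ≡ true
    complete x y x∈A y∈B with ∈⟦⟧⁻ InB? y∈B
    ... | y∈S , a↛y = across (∈⟦⟧⁻ InA? x∈A) y∈S a↛y

    cover : ∀ {x} → x ∈ S → x ∈ A ⊎ x ∈ B
    cover {x} x∈S with reach? S a x
    ... | yes a⇝x = inj₁ (∈⟦⟧⁺ InA? a⇝x)
    ... | no a↛x  = inj₂ (∈⟦⟧⁺ InB? (x∈S , a↛x))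

  TwoCover : Set
  TwoCover = Σ (Biclique G) λ β → Σ (Biclique G) λ γ → ∀ x → x ∈B β ⊎ x ∈B γ

  TwoCover⇒BP2 : TwoCover → BP2 G
  TwoCover⇒BP2 (β , γ , cover) =
    β ∷ γ ∷ [] , s≤s (s≤s z≤n) , λ x → [ Any.here , Any.there ∘ Any.here ]′ (cover x)

  BP2⇒TwoCover : Fin n → BP2 G → TwoCover
  BP2⇒TwoCover v ([] , _ , cover) with cover v
  ... | ()
  BP2⇒TwoCover v (β ∷ [] , _ , cover) = β , β , λ x → inj₁ (singleton⁻ (cover x))
  BP2⇒TwoCover v (β ∷ γ ∷ [] , _ , cover) = β , γ , λ x → one-of-two (cover x)
    where
    one-of-two : ∀ {x} → Any (x ∈B_) (β ∷ γ ∷ []) → x ∈B β ⊎ x ∈B γ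
    one-of-two (Any.here x∈β)            = inj₁ x∈β
    one-of-two (Any.there (Any.here x∈γ)) = inj₂ x∈γ
  BP2⇒TwoCover v (_ ∷ _ ∷ _ ∷ _ , s≤s (s≤s ()) , _)

  -- (⇒) If G ∉ BP2, every failure of the condition would give a two-cover.
  ¬BP2⇒condition : Fin n → ¬ BP2 G → Condition
  ¬BP2⇒condition v₀ ¬bp2 = connected , no-cut-vertex , cuts-connected
    where
    ¬two-cover : ¬ TwoCover
    ¬two-cover = ¬bp2 ∘ TwoCover⇒BP2

    connected : Connected (co G)
    connected = (v₀ , ∈⊤) , λ u v _ _ → decidable-stable (reach? ⊤ u v) λ u↛v →
      let (β , cover) = component-split (u , v , ∈⊤ , ∈⊤ , u↛v)
      in ¬two-cover (β , β , λ _ → inj₁ (cover ∈⊤))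

    no-cut-vertex : ∀ v → ¬ IsCutVertex (co G) v
    no-cut-vertex v cut with component-split cut
    ... | β , cover-rest = ¬two-cover (single v , β , cover)
      where
      cover : ∀ x → x ≡ v ⊎ x ∈B β
      cover x with x ≟ v
      ... | yes x≡v = inj₁ x≡v
      ... | no x≢v  = inj₂ (cover-rest (x∈p∧x≢y⇒x∈p-y ∈⊤ x≢v))

    -- β covers ∁ X; X itself is empty, or lies in a second biclique when Ḡ[X] is disconnected.
    cuts-connected : ∀ X → IsVertexCut (co G) X → ConnectedOn (co G) X
    cuts-connected X cut with component-split cut
    ... | β , cover-∁X = nonempty , connected-on-X
      where
      with-rest : (γ : Biclique G) → (∀ {x} → x ∈ X → x ∈B γ) → ∀ x → x ∈B β ⊎ x ∈B γ
      with-rest _ cover-X x with x ∈? X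
      ... | yes x∈X = inj₂ (cover-X x∈X)
      ... | no x∉X  = inj₁ (cover-∁X (x∉p⇒x∈∁p x∉X))

      nonempty : Nonempty X
      nonempty = decidable-stable (nonempty? X) λ X-empty →
        ¬two-cover (β , β , with-rest β λ x∈X → ⊥-elim (X-empty (_ , x∈X)))

      connected-on-X : ∀ u v → u ∈ X → v ∈ X → Reach (co G) X u v
      connected-on-X u v u∈X v∈X = decidable-stable (reach? X u v) λ u↛v →
        let (γ , cover-X) = component-split (u , v , u∈X , v∈X , u↛v)
        in ¬two-cover (β , γ , with-rest γ cover-X)

  complement-connected : Condition → ∀ {S} → DisconnectedOn (co G) S → ConnectedOn (co G) (∁ S)
  complement-connected (_ , _ , cuts-connected) {S} disconnected =
    cuts-connected (∁ S) (subst (DisconnectedOn (co G)) (sym (∁-involutive S)) disconnected)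

  record Sides : Set where
    constructor sides
    field
      left right     : Subset n
      left-nonempty  : Nonempty left
      right-nonempty : Nonempty right
      complete       : Complete (_∈ left) (_∈ right)
  open Sides

  _∈ˢ_ : Fin n → Sides → Set
  x ∈ˢ β = x ∈ left β ⊎ x ∈ right β

  flip : Sides → Sides
  flip (sides L R L≠∅ R≠∅ LR) = sides R L R≠∅ L≠∅ λ r l → trans (adj-sym G _ _) (LR l r)

  vertices : Sides → Subset n
  vertices β = left β ∪ right β

  ∉vertices : ∀ {x} (β : Sides) → x ∈ ∁ (vertices β) → ¬ x ∈ˢ β
  ∉vertices _ x∈ = x∈∁p⇒x∉p x∈ ∘ x∈p∪q⁺

  -- Under the condition every biclique misses a vertex: its complement is a vertex cut.
  outside-vertex : Condition → (β : Sides) → ∃[ x ] ¬ x ∈ˢ β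
  outside-vertex cond β with left-nonempty β | right-nonempty β
  ... | a , a∈L | b , b∈R =
    let ((x , x∈) , _) = complement-connected cond
          (separated (x∈p∪q⁻ _ _) (complete β) (x∈p∪q⁺ (inj₁ a∈L)) a∈L (x∈p∪q⁺ (inj₂ b∈R)) b∈R)
    in x , ∉vertices β x∈

  -- A vertex w and a biclique β cannot cover V: w lies outside β, so Ḡ - w ⊆ β is separated.
  vertex-and-sides : Condition → ∀ w (β : Sides) → ¬ (∀ x → x ≡ w ⊎ x ∈ˢ β)
  vertex-and-sides cond@(_ , no-cut-vertex , _) w β cover
    with left-nonempty β | right-nonempty β | outside-vertex cond β
  ... | a , a∈L | b , b∈R | x , x∉β =
    no-cut-vertex w (separated rest-in-β (complete β) (in-rest (inj₁ a∈L)) a∈L (in-rest (inj₂ b∈R)) b∈R)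
    where
    w∉β : ¬ w ∈ˢ β
    w∉β w∈β with cover x
    ... | inj₁ x≡w = x∉β (subst (_∈ˢ β) (sym x≡w) w∈β)
    ... | inj₂ x∈β = x∉β x∈β
    in-rest : ∀ {z} → z ∈ˢ β → z ∈ ⊤ - w
    in-rest z∈β = x∈p∧x≢y⇒x∈p-y ∈⊤ λ { refl → w∉β z∈β }
    rest-in-β : ∀ {z} → z ∈ ⊤ - w → z ∈ˢ β
    rest-in-β {z} z∈ = [ (λ z≡w → ⊥-elim (x∈p-y⇒x≢y z∈ z≡w)) , id ]′ (cover z)

  -- Let β, γ cover V with x ∈ left γ outside β and y ∈ left β outside γ.  Then
  -- S = right β ∪ ∁ γ lies in β and separates y from right β, so Ḡ[∁ S] is connected;
  -- since ∁ S ⊆ γ contains x ∈ left γ, it misses right γ, i.e. right γ ⊆ right β.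
  right-nested : Condition → (β γ : Sides) → (∀ z → z ∈ˢ β ⊎ z ∈ˢ γ) →
                 ∀ {x y} → ¬ x ∈ˢ β → x ∈ left γ → ¬ y ∈ˢ γ → y ∈ left β →
                 right γ ⊆ right β
  right-nested cond β γ cover {x} {y} x∉β x∈Lγ y∉γ y∈Lβ {z} z∈Rγ
    with right-nonempty β
  ... | b , b∈Rβ = decidable-stable (z ∈? right β) λ z∉Rβ →
      no-crossing ∁S⊆γ (complete γ) x∈Lγ z∈Rγ
        (proj₂ ∁S-connected x z (in-∁S (x∉β ∘ inj₂) (inj₁ x∈Lγ)) (in-∁S z∉Rβ (inj₂ z∈Rγ)))
    where
    S : Subset n
    S = right β ∪ ∁ (vertices γ)

    S⊆β : ∀ {v} → v ∈ S → v ∈ˢ β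
    S⊆β {v} v∈S with x∈p∪q⁻ _ _ v∈S
    ... | inj₁ v∈Rβ = inj₂ v∈Rβ
    ... | inj₂ v∉γ  = [ id , ⊥-elim ∘ ∉vertices γ v∉γ ]′ (cover v)

    ∁S-connected : ConnectedOn (co G) (∁ S)
    ∁S-connected = complement-connected cond
      (separated S⊆β (complete β) (x∈p∪q⁺ (inj₂ (x∉p⇒x∈∁p (y∉γ ∘ x∈p∪q⁻ _ _)))) y∈Lβ
                                  (x∈p∪q⁺ (inj₁ b∈Rβ)) b∈Rβ)

    in-∁S : ∀ {v} → v ∉ right β → v ∈ˢ γ → v ∈ ∁ S
    in-∁S v∉Rβ v∈γ = x∉p⇒x∈∁p λ v∈S →
      [ v∉Rβ , (λ v∉γ → ∉vertices γ v∉γ v∈γ) ]′ (x∈p∪q⁻ _ _ v∈S)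

    ∁S⊆γ : ∀ {v} → v ∈ ∁ S → v ∈ˢ γ
    ∁S⊆γ {v} v∈∁S = decidable-stable ((v ∈? left γ) ⊎-dec (v ∈? right γ)) λ v∉γ →
      x∈∁p⇒x∉p v∈∁S (x∈p∪q⁺ (inj₂ (x∉p⇒x∈∁p (v∉γ ∘ x∈p∪q⁻ _ _))))

  -- With both orientations fixed as in right-nested, right β = right γ is completely
  -- joined to left β ∪ left γ; these cover V, so Ḡ would be disconnected.
  oriented-sides : Condition → (β γ : Sides) → (∀ z → z ∈ˢ β ⊎ z ∈ˢ γ) →
                   ∀ {x y} → ¬ x ∈ˢ β → x ∈ left γ → ¬ y ∈ˢ γ → y ∈ left β → ⊥
  oriented-sides cond β γ cover x∉β x∈Lγ y∉γ y∈Lβ with right-nonempty β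
  ... | b , b∈Rβ =
    no-crossing regroup joined b∈Rβ (inj₂ x∈Lγ) (proj₂ (proj₁ cond) _ _ ∈⊤ ∈⊤)
    where
    Rγ⊆Rβ : right γ ⊆ right β
    Rγ⊆Rβ = right-nested cond β γ cover x∉β x∈Lγ y∉γ y∈Lβ
    Rβ⊆Rγ : right β ⊆ right γ
    Rβ⊆Rγ = right-nested cond γ β (⊎-swap ∘ cover) y∉γ y∈Lβ x∉β x∈Lγ

    regroup : ∀ {z} → z ∈ ⊤ → z ∈ right β ⊎ (z ∈ left β ⊎ z ∈ left γ)
    regroup {z} _ with cover z
    ... | inj₁ (inj₁ z∈Lβ) = inj₂ (inj₁ z∈Lβ)
    ... | inj₁ (inj₂ z∈Rβ) = inj₁ z∈Rβ
    ... | inj₂ (inj₁ z∈Lγ) = inj₂ (inj₂ z∈Lγ)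
    ... | inj₂ (inj₂ z∈Rγ) = inj₁ (Rγ⊆Rβ z∈Rγ)

    joined : Complete (_∈ right β) (λ z → z ∈ left β ⊎ z ∈ left γ)
    joined r (inj₁ l) = trans (adj-sym G _ _) (complete β l r)
    joined r (inj₂ l) = trans (adj-sym G _ _) (complete γ l (Rβ⊆Rγ r))

  -- Two bicliques cannot cover V: a vertex outside each lies in the other, and flipping
  -- the bicliques puts both vertices on the left as oriented-sides requires.
  two-sides : Condition → (β γ : Sides) → ¬ (∀ z → z ∈ˢ β ⊎ z ∈ˢ γ)
  two-sides cond β γ cover with outside-vertex cond β | outside-vertex cond γ
  ... | x , x∉β | y , y∉γ =
    orient ([ ⊥-elim ∘ x∉β , id ]′ (cover x)) ([ id , ⊥-elim ∘ y∉γ ]′ (cover y))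
    where
    orient : x ∈ˢ γ → y ∈ˢ β → ⊥
    orient (inj₁ x∈L) (inj₁ y∈L) =
      oriented-sides cond β γ cover x∉β x∈L y∉γ y∈L
    orient (inj₂ x∈R) (inj₁ y∈L) =
      oriented-sides cond β (flip γ) (⊎-map id ⊎-swap ∘ cover) x∉β x∈R (y∉γ ∘ ⊎-swap) y∈L
    orient (inj₁ x∈L) (inj₂ y∈R) =
      oriented-sides cond (flip β) γ (⊎-map ⊎-swap id ∘ cover) (x∉β ∘ ⊎-swap) x∈L y∉γ y∈R
    orient (inj₂ x∈R) (inj₂ y∈R) =
      oriented-sides cond (flip β) (flip γ) (⊎-map ⊎-swap ⊎-swap ∘ cover)
                     (x∉β ∘ ⊎-swap) x∈R (y∉γ ∘ ⊎-swap) y∈R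

  condition⇒¬TwoCover : 3 ≤ n → Condition → ¬ TwoCover
  condition⇒¬TwoCover 3≤n cond (single v , single w , cover) with third 3≤n v w
  ... | x , x≢v , x≢w = [ x≢v , x≢w ]′ (cover x)
  condition⇒¬TwoCover _ cond (single w , bip A B A≠∅ B≠∅ _ AB , cover) =
    vertex-and-sides cond w (sides A B A≠∅ B≠∅ (AB _ _)) cover
  condition⇒¬TwoCover _ cond (bip A B A≠∅ B≠∅ _ AB , single w , cover) =
    vertex-and-sides cond w (sides A B A≠∅ B≠∅ (AB _ _)) (⊎-swap ∘ cover)
  condition⇒¬TwoCover _ cond (bip A₁ B₁ A₁≠∅ B₁≠∅ _ A₁B₁ , bip A₂ B₂ A₂≠∅ B₂≠∅ _ A₂B₂ , cover) =
    two-sides cond (sides A₁ B₁ A₁≠∅ B₁≠∅ (A₁B₁ _ _)) (sides A₂ B₂ A₂≠∅ B₂≠∅ (A₂B₂ _ _)) cover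

lemma4 : ∀ (n : ℕ) → 3 ≤ n → (G : Graph n) →
    (¬ BP2 G) ⇔ (Connected (co G)
                 × (∀ (v : Fin n) → ¬ IsCutVertex (co G) v)
                 × (∀ (X : Subset n) → IsVertexCut (co G) X → ConnectedOn (co G) X))
lemma4 n 3≤n G =
  mk⇔ (¬BP2⇒condition G v₀)
      (λ cond bp2 → condition⇒¬TwoCover G 3≤n cond (BP2⇒TwoCover G v₀ bp2))
  where
  v₀ : Fin n
  v₀ = fromℕ< (≤-trans (s≤s z≤n) 3≤n)
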